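{- Let $G$ be a graph on $n$ vertices which is the complement of a $c$-closed graph. Then the number of inclusion-maximal sets $S\subseteq V(G)$ such that $G[S]$ is a star is at most $n^3\cdot \mathcal{M}_0(c-1)$.
   Context: Graphs are finite, simple and undirected. A graph $H$ is $c$-closed if any two non-adjacent vertices have at most $c-1$ common neighbors; $G$ is the complement of a $c$-closed graph iff for any two adjacent vertices $u,v$ of $G$ at most $c-1$ vertices of $G$ are adjacent to neither $u$ nor $v$ (excluding $u,v$). Here a star is any graph that is the vertex-disjoint union of a tree of diameter at most $2$ and an independent set. $\mathcal{M}_0(N)$ is the maximum number of maximal independent sets in a graph on $N$ vertices. -}

module Defs where

open import Data.Nat using (ℕ; _≤_; _<_)
open import Data.Bool using (Bool; true; false; not; _∨_)
open import Data.Fin using (Fin; _≟_)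
open import Data.Fin.Subset using (Subset; _∈_; _∉_; _⊆_; ∣_∣)
open import Data.Vec using (tabulate)
open import Data.List using (List; length)
open import Data.List.Relation.Unary.All using (All)
open import Data.List.Relation.Unary.Unique.Propositional using (Unique)
open import Data.Product using (Σ; ∃; _×_)
open import Data.Sum using (_⊎_)
open import Relation.Nullary.Decidable using (⌊_⌋)
open import Relation.Binary.PropositionalEquality using (_≡_; _≢_)

record Graph (n : ℕ) : Set where
  field
    E     : Fin n → Fin n → Bool
    sym   : ∀ i j → E i j ≡ E j i
    irr   : ∀ i → E i i ≡ false
open Graph public

Adj : ∀ {n} → Graph n → Fin n → Fin n → Set
Adj G i j = E G i j ≡ true

nonNbrs : ∀ {n} → Graph n → Fin n → Fin n → Subset n
nonNbrs G u v =
  tabulate (λ w → not (E G u w ∨ E G v w ∨ ⌊ w ≟ u ⌋ ∨ ⌊ w ≟ v ⌋))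

-- G is the complement of a c-closed graph:
-- for adjacent u,v at most c-1 (i.e. fewer than c) vertices other than u,v
-- are adjacent to neither u nor v.
CoClosed : ∀ {n} → ℕ → Graph n → Set
CoClosed c G = ∀ u v → Adj G u v → ∣ nonNbrs G u v ∣ < c

Independent : ∀ {n} → Graph n → Subset n → Set
Independent G S = ∀ x y → x ∈ S → y ∈ S → E G x y ≡ false

MaximalIndependent : ∀ {n} → Graph n → Subset n → Set
MaximalIndependent G S =
  Independent G S × (∀ S′ → S ⊆ S′ → Independent G S′ → S′ ⊆ S)

-- G[T] is a tree of diameter at most 2: T has a vertex x adjacent to all
-- other vertices of T and no other edges inside T (K₁, K₂ or K_{1,k}).
TreeDiam≤2 : ∀ {n} → Graph n → Subset n → Set
TreeDiam≤2 G T = ∃ λ x → x ∈ T ×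
  (∀ y → y ∈ T → y ≢ x → Adj G x y) ×
  (∀ y z → y ∈ T → z ∈ T → y ≢ x → z ≢ x → E G y z ≡ false)

IsStar : ∀ {n} → Graph n → Subset n → Set
IsStar {n} G S = Σ (Subset n) λ T → Σ (Subset n) λ I →
    (∀ x → x ∈ S → (x ∈ T × x ∉ I) ⊎ (x ∉ T × x ∈ I))
  × (T ⊆ S) × (I ⊆ S)
  × TreeDiam≤2 G T × Independent G I
  × (∀ x y → x ∈ T → y ∈ I → E G x y ≡ false)

MaximalStar : ∀ {n} → Graph n → Subset n → Set
MaximalStar G S = IsStar G S × (∀ S′ → S ⊆ S′ → IsStar G S′ → S′ ⊆ S)

-- m = M₀(N): the maximum number of maximal independent sets of a graph on
-- N vertices (an upper bound for all such graphs, attained by some graph).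
-- "H has at least/at most k maximal independent sets" is expressed via
-- duplicate-free lists of maximal independent sets.
IsM₀ : ℕ → ℕ → Set
IsM₀ N m =
    (∀ (H : Graph N) (L : List (Subset N)) → Unique L →
       All (MaximalIndependent H) L → length L ≤ m)
  × (Σ (Graph N) λ H → Σ (List (Subset N)) λ L →
       Unique L × All (MaximalIndependent H) L × length L ≡ m)

-- Every maximal star S has a center x, and S - x is a maximal independent set of G - x,
-- so it suffices to count maximal independent sets of induced subgraphs G[X]. Fix v ∈ X and
-- a maximal independent set J of G[X]. Either J - v is maximal independent in G[X - v], or
-- some z ∈ X - v outside J has v as its only neighbour in J; then v ~ z, and J - v is maximal
-- independent in G restricted to the common non-neighbours of v and z in X - v. Since G is
-- the complement of a c-closed graph that set has fewer than c vertices, so for each z there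
-- are at most M₀(c - 1) possibilities for J - v. As J is determined by J - v in both cases,
--   #MIS(G[X]) ≤ #MIS(G[X - v]) + n · M₀(c - 1),
-- whence #MIS(G - x) ≤ 1 + (n - 1) · n · M₀(c - 1), and summing over the n possible
-- centers gives at most n³ · M₀(c - 1) maximal stars (using M₀(c - 1) ≥ 1).
module Submission where

open import Defs hiding (sym)
open import Data.Nat using (ℕ; zero; suc; _≤_; _<_; _+_; _*_; _^_; _∸_; z≤n; s≤s)
open import Data.Nat.Properties using (≤-trans; ≤-reflexive; <-≤-trans; ≤-pred; n≮0; ∸-monoˡ-≤; m≤m+n; +-comm; +-suc; +-mono-≤; +-monoˡ-≤; *-monoʳ-≤; module ≤-Reasoning)
open import Data.Nat.Tactic.RingSolver using (solve-∀)
open import Data.Bool using (Bool; true; false; not; _∨_)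
open import Data.Bool.Properties using (¬-not) renaming (_≟_ to _≟ᵇ_)
open import Data.Maybe as Maybe using (Maybe; just; nothing; maybe)
open import Data.Fin using (Fin; zero; suc; _≟_)
open import Data.Fin.Properties using (any?)
open import Data.Fin.Subset using (Subset; _∈_; _∉_; _⊆_; _-_; _∩_; _∪_; ⁅_⁆; ⊤; ∣_∣; Empty)
open import Data.Fin.Subset.Properties using (_∈?_; nonempty?; ⊆-antisym; ⊆-reflexive; ⊆⊤; ∈⊤; ∣⊤∣≡n; p─q⊆p; x∈p∧x≢y⇒x∈p-y; x∈p⇒∣p-x∣<∣p∣; x∈p∩q⁺; x∈p∩q⁻; ∣p∩q∣≤∣p∣; p⊆p∪q; q⊆p∪q; x∈p∪q⁻; x∈⁅x⁆; x∈⁅y⁆⇒x≡y)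
open import Data.Vec using (_∷_; []; here; there; lookup; tabulate)
open import Data.Vec.Properties using (lookup∘tabulate; []=⇒lookup; lookup⇒[]=)
open import Data.List using (List; []; _∷_; length; map)
open import Data.List.Properties using (length-map)
open import Data.List.Relation.Unary.All as All using (All; []; _∷_)
import Data.List.Relation.Unary.All.Properties as All
open import Data.List.Relation.Unary.AllPairs using (AllPairs; []; _∷_)
open import Data.List.Relation.Unary.Unique.Propositional using (Unique)
open import Data.List.Relation.Binary.Sublist.Propositional using ([]; _∷_; _∷ʳ_) renaming (_⊆_ to _⊑_)
open import Data.List.Relation.Binary.Sublist.Propositional.Properties using (All-resp-⊆)
open import Data.Product as Prod using (∃; ∃₂; _×_; _,_; proj₁; proj₂)
open import Data.Sum as Sum using (_⊎_; inj₁; inj₂; [_,_])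
open import Data.Empty using (⊥-elim)
open import Function using (_∘_)
open import Relation.Nullary using (Dec; ¬_; yes; no)
open import Relation.Nullary.Decidable using (_×-dec_; ¬?; dec-false; ⌊_⌋; isYes≗does)
open import Relation.Binary.PropositionalEquality using (_≡_; _≢_; refl; trans; sym; cong; cong₂; subst)

private
  variable
    A B : Set
    P Q R : A → Set
    k l m n N : ℕ
    p q S T I : Subset n
    x y z : Fin n

-- Counting

AtMost : ℕ → (A → Set) → Set
AtMost {A} k P = (L : List A) → Unique L → All P L → length L ≤ k

atMost-mono : k ≤ l → AtMost k P → AtMost l P
atMost-mono k≤l bound L u ps = ≤-trans (bound L u ps) k≤l

atMost-subsingleton : (∀ {a b} → P a → P b → a ≡ b) → AtMost 1 P
atMost-subsingleton same []          _               _              = z≤n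
atMost-subsingleton same (_ ∷ [])    _               _              = s≤s z≤n
atMost-subsingleton same (_ ∷ _ ∷ _) ((a≢b ∷ _) ∷ _) (pa ∷ pb ∷ _) = ⊥-elim (a≢b (same pa pb))

atMost-⊆ : (∀ {a} → P a → Q a) → AtMost k Q → AtMost k P
atMost-⊆ P⊆Q bound L u ps = bound L u (All.map P⊆Q ps)

atMost-byWitness : (∀ {a} → P a → AtMost k P) → AtMost k P
atMost-byWitness bound []      _ _           = z≤n
atMost-byWitness bound (a ∷ L) u (pa ∷ ps) = bound pa (a ∷ L) u (pa ∷ ps)

unique-map⁺ : {f : A → B} → (∀ {a b} → P a → P b → f a ≡ f b → a ≡ b) →
  ∀ {L} → All P L → Unique L → Unique (map f L)
unique-map⁺ inj []        []          = []
unique-map⁺ inj (pa ∷ ps) (a∉L ∷ u) =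
  All.map⁺ (All.zipWith (λ (pb , a≢b) fa≡fb → a≢b (inj pa pb fa≡fb)) (ps , a∉L))
    ∷ unique-map⁺ inj ps u

atMost-injective : (f : A → B) → (∀ {a} → P a → Q (f a)) →
  (∀ {a b} → P a → P b → f a ≡ f b → a ≡ b) → AtMost k Q → AtMost k P
atMost-injective f into inj bound L u ps =
  subst (_≤ _) (length-map f L) (bound (map f L) (unique-map⁺ inj ps u) (All.map⁺ (All.map into ps)))

AllPairs-resp-⊇ : {S : A → A → Set} {L₁ L : List A} → L₁ ⊑ L → AllPairs S L → AllPairs S L₁
AllPairs-resp-⊇ []         []         = []
AllPairs-resp-⊇ (_ ∷ʳ sub) (_ ∷ ss)   = AllPairs-resp-⊇ sub ss
AllPairs-resp-⊇ (refl ∷ sub) (sa ∷ ss) = All-resp-⊆ sub sa ∷ AllPairs-resp-⊇ sub ss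

partition-⊎ : ∀ {L : List A} → All (λ a → Q a ⊎ R a) L →
  ∃₂ λ L₁ L₂ → L₁ ⊑ L × L₂ ⊑ L × All Q L₁ × All R L₂ ×
    length L ≡ length L₁ + length L₂
partition-⊎ [] = [] , [] , [] , [] , [] , [] , refl
partition-⊎ {L = a ∷ _} (inj₁ qa ∷ ps) with partition-⊎ ps
... | L₁ , L₂ , s₁ , s₂ , qs , rs , len =
  a ∷ L₁ , L₂ , refl ∷ s₁ , a ∷ʳ s₂ , qa ∷ qs , rs , cong suc len
partition-⊎ {L = a ∷ _} (inj₂ ra ∷ ps) with partition-⊎ ps
... | L₁ , L₂ , s₁ , s₂ , qs , rs , len =
  L₁ , a ∷ L₂ , a ∷ʳ s₁ , refl ∷ s₂ , qs , ra ∷ rs , trans (cong suc len) (sym (+-suc _ _))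

atMost-⊎ : AtMost k Q → AtMost l R → AtMost (k + l) (λ a → Q a ⊎ R a)
atMost-⊎ boundQ boundR L u ps with partition-⊎ ps
... | L₁ , L₂ , s₁ , s₂ , qs , rs , len = ≤-trans (≤-reflexive len)
  (+-mono-≤ (boundQ L₁ (AllPairs-resp-⊇ s₁ u) qs) (boundR L₂ (AllPairs-resp-⊇ s₂ u) rs))

atMost-⋃ : {Q : Fin k → A → Set} → (∀ i → AtMost m (Q i)) →
  AtMost (k * m) (λ a → ∃ λ i → Q i a)
atMost-⋃ {zero}  bound = atMost-byWitness λ ()
atMost-⋃ {suc k} {Q = Q} bound =
  atMost-⊆ split (atMost-⊎ (bound zero) (atMost-⋃ (λ i → bound (suc i))))
  where
  split : ∀ {a} → (∃ λ i → Q i a) → Q zero a ⊎ ∃ λ i → Q (suc i) a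
  split (zero , q) = inj₁ q
  split (suc i , q) = inj₂ (i , q)

x∉p-x : ∀ (p : Subset n) x → x ∉ p - x
x∉p-x (_ ∷ p) zero    ()
x∉p-x (_ ∷ p) (suc x) (there x∈p-x) = x∉p-x p x x∈p-x

x∈p-y⇒x∈p : x ∈ p - y → x ∈ p
x∈p-y⇒x∈p {p = p} {y = y} = p─q⊆p p ⁅ y ⁆

x∈p-y⇒x≢y : x ∈ p - y → x ≢ y
x∈p-y⇒x≢y {p = p} x∈p-y refl = x∉p-x p _ x∈p-y

p⊆q⇒p-x⊆q-x : p ⊆ q → p - x ⊆ q - x
p⊆q⇒p-x⊆q-x p⊆q y∈p-x = x∈p∧x≢y⇒x∈p-y (p⊆q (x∈p-y⇒x∈p y∈p-x)) (x∈p-y⇒x≢y y∈p-x)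

p-x⊆q-x⇒p⊆q : (x ∈ p → x ∈ q) → p - x ⊆ q - x → p ⊆ q
p-x⊆q-x⇒p⊆q {x = x} x∈p⇒x∈q sub {y} y∈p with y ≟ x
... | yes refl = x∈p⇒x∈q y∈p
... | no y≢x = x∈p-y⇒x∈p (sub (x∈p∧x≢y⇒x∈p-y y∈p y≢x))

∈-tabulate⁺ : ∀ {f : Fin n → Bool} {x} → f x ≡ true → x ∈ tabulate f
∈-tabulate⁺ {f = f} {x = x} fx = lookup⇒[]= x (tabulate f) (trans (lookup∘tabulate f x) fx)

∈-tabulate⁻ : ∀ {f : Fin n → Bool} {x} → x ∈ tabulate f → f x ≡ true
∈-tabulate⁻ {f = f} {x = x} x∈ = trans (sym (lookup∘tabulate f x)) ([]=⇒lookup x∈)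

p-x≡q-x⇒p≡q : x ∈ p → x ∈ q → p - x ≡ q - x → p ≡ q
p-x≡q-x⇒p≡q x∈p x∈q eq = ⊆-antisym
  (p-x⊆q-x⇒p⊆q (λ _ → x∈q) (⊆-reflexive eq)) (p-x⊆q-x⇒p⊆q (λ _ → x∈p) (⊆-reflexive (sym eq)))

∣⊤-x∣≤n∸1 : (x : Fin n) → ∣ ⊤ - x ∣ ≤ n ∸ 1
∣⊤-x∣≤n∸1 {n} x =
  ∸-monoˡ-≤ 1 (subst (∣ ⊤ - x ∣ <_) (∣⊤∣≡n n) (x∈p⇒∣p-x∣<∣p∣ (∈⊤ {x = x})))

-- Maximal independent sets of induced subgraphs

false≢true : false ≢ true
false≢true ()

⌊⌋-false : (a? : Dec A) → ¬ A → ⌊ a? ⌋ ≡ false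
⌊⌋-false a? ¬a = trans (isYes≗does a?) (dec-false a? ¬a)

module _ (G : Graph n) where

  Adj-sym : ∀ {u v} → Adj G u v → Adj G v u
  Adj-sym {u} {v} adj = trans (Graph.sym G v u) adj

  nonAdj-sym : ∀ {u v} → E G u v ≡ false → E G v u ≡ false
  nonAdj-sym {u} {v} e = trans (Graph.sym G v u) e

  Adj⇒≢ : ∀ {u v} → Adj G u v → u ≢ v
  Adj⇒≢ {u} adj refl = false≢true (trans (sym (Graph.irr G u)) adj)

  NeighbourIn : Subset n → Fin n → Set
  NeighbourIn J z = ∃ λ y → y ∈ J × Adj G z y

  neighbourIn? : ∀ J z → Dec (NeighbourIn J z)
  neighbourIn? J z = any? (λ y → y ∈? J ×-dec E G z y ≟ᵇ true)

  independent-⊆ : ∀ {J J′} → J′ ⊆ J → Independent G J → Independent G J′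
  independent-⊆ J′⊆J ind x y x∈J′ y∈J′ = ind x y (J′⊆J x∈J′) (J′⊆J y∈J′)

  ∈-nonNbrs⁺ : ∀ {u v t} → E G u t ≡ false → E G v t ≡ false → t ≢ u → t ≢ v →
    t ∈ nonNbrs G u v
  ∈-nonNbrs⁺ {u} {v} {t} eu ev t≢u t≢v = ∈-tabulate⁺ (cong not
    (cong₂ _∨_ eu (cong₂ _∨_ ev (cong₂ _∨_ (⌊⌋-false (t ≟ u) t≢u) (⌊⌋-false (t ≟ v) t≢v)))))

  ∈-nonNbrs⁻ : ∀ {u v t} → t ∈ nonNbrs G u v → E G u t ≡ false
  ∈-nonNbrs⁻ {u} {v} {t} t∈ with E G u t | ∈-tabulate⁻ t∈
  ... | false | _ = refl

  record MaximalIndependentIn (X J : Subset n) : Set where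
    field
      J⊆X         : J ⊆ X
      independent : Independent G J
      dominating  : ∀ {z} → z ∈ X → z ∉ J → NeighbourIn J z
  open MaximalIndependentIn

  mis-empty : ∀ {X J₁ J₂} → Empty X →
    MaximalIndependentIn X J₁ → MaximalIndependentIn X J₂ → J₁ ≡ J₂
  mis-empty empty mis₁ mis₂ = ⊆-antisym
    (λ i∈J₁ → ⊥-elim (empty (_ , J⊆X mis₁ i∈J₁)))
    (λ i∈J₂ → ⊥-elim (empty (_ , J⊆X mis₂ i∈J₂)))

  module _ {X : Subset n} {v : Fin n} where

    mis-∈-transfer : ∀ {J₁ J₂} → v ∈ X → MaximalIndependentIn X J₁ → MaximalIndependentIn X J₂ →
      J₂ - v ⊆ J₁ - v → v ∈ J₁ → v ∈ J₂
    mis-∈-transfer {J₁} {J₂} v∈X mis₁ mis₂ J₂-v⊆J₁-v v∈J₁ with v ∈? J₂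
    ... | yes v∈J₂ = v∈J₂
    ... | no v∉J₂ with dominating mis₂ v∈X v∉J₂
    ...   | y , y∈J₂ , adj = ⊥-elim (false≢true (trans (sym (independent mis₁ v y v∈J₁ y∈J₁)) adj))
      where
      y∈J₁ : y ∈ J₁
      y∈J₁ = x∈p-y⇒x∈p (J₂-v⊆J₁-v (x∈p∧x≢y⇒x∈p-y y∈J₂ (Adj⇒≢ adj ∘ sym)))

    mis-remove-injective : ∀ {J₁ J₂} → v ∈ X → MaximalIndependentIn X J₁ → MaximalIndependentIn X J₂ →
      J₁ - v ≡ J₂ - v → J₁ ≡ J₂
    mis-remove-injective v∈X mis₁ mis₂ eq = ⊆-antisym
      (p-x⊆q-x⇒p⊆q (mis-∈-transfer v∈X mis₁ mis₂ (⊆-reflexive (sym eq))) (⊆-reflexive eq))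
      (p-x⊆q-x⇒p⊆q (mis-∈-transfer v∈X mis₂ mis₁ (⊆-reflexive eq)) (⊆-reflexive (sym eq)))

    mis-remove : ∀ {J} → MaximalIndependentIn X J →
      (∀ {z} → z ∈ X - v → z ∉ J → NeighbourIn (J - v) z) → MaximalIndependentIn (X - v) (J - v)
    mis-remove mis dom = record
      { J⊆X         = p⊆q⇒p-x⊆q-x (J⊆X mis)
      ; independent = independent-⊆ x∈p-y⇒x∈p (independent mis)
      ; dominating  = λ z∈X-v z∉J-v →
          dom z∈X-v (λ z∈J → z∉J-v (x∈p∧x≢y⇒x∈p-y z∈J (x∈p-y⇒x≢y z∈X-v)))
      }

    mis-privateNeighbour : ∀ {J z} → MaximalIndependentIn X J → z ∈ X - v → z ∉ J →
      ¬ NeighbourIn (J - v) z → Adj G v z × MaximalIndependentIn (nonNbrs G v z ∩ (X - v)) (J - v)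
    mis-privateNeighbour {J} {z} mis z∈X-v z∉J ¬nbr
      with dominating mis (x∈p-y⇒x∈p z∈X-v) z∉J
    ... | y , y∈J , adj with y ≟ v
    ...   | no y≢v = ⊥-elim (¬nbr (y , x∈p∧x≢y⇒x∈p-y y∈J y≢v , adj))
    ...   | yes refl = Adj-sym adj , record
      { J⊆X         = J-v⊆
      ; independent = independent-⊆ x∈p-y⇒x∈p (independent mis)
      ; dominating  = dom
      }
      where
      J-v⊆ : J - v ⊆ nonNbrs G v z ∩ (X - v)
      J-v⊆ {i} i∈J-v = x∈p∩q⁺ (∈-nonNbrs⁺ (independent mis v i y∈J i∈J) Ezi (x∈p-y⇒x≢y i∈J-v) i≢z ,
                               p⊆q⇒p-x⊆q-x (J⊆X mis) i∈J-v)
        where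
        i∈J = x∈p-y⇒x∈p i∈J-v
        Ezi : E G z i ≡ false
        Ezi = ¬-not (λ adj′ → ¬nbr (i , i∈J-v , adj′))
        i≢z : i ≢ z
        i≢z refl = z∉J i∈J
      dom : ∀ {t} → t ∈ nonNbrs G v z ∩ (X - v) → t ∉ J - v → NeighbourIn (J - v) t
      dom {t} t∈ t∉J-v with x∈p∩q⁻ (nonNbrs G v z) (X - v) t∈
      ... | t∈nonNbrs , t∈X-v with dominating mis (x∈p-y⇒x∈p t∈X-v) t∉J
        where
        t∉J : t ∉ J
        t∉J t∈J = t∉J-v (x∈p∧x≢y⇒x∈p-y t∈J (x∈p-y⇒x≢y t∈X-v))
      ... | u , u∈J , adj′ = u , x∈p∧x≢y⇒x∈p-y u∈J u≢v , adj′
        where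
        u≢v : u ≢ v
        u≢v refl = false≢true (trans (sym (nonAdj-sym (∈-nonNbrs⁻ t∈nonNbrs))) adj′)

    mis-remove-cases : ∀ {J} → MaximalIndependentIn X J →
      MaximalIndependentIn (X - v) (J - v) ⊎
      ∃ λ w → Adj G v w × MaximalIndependentIn (nonNbrs G v w ∩ (X - v)) (J - v)
    mis-remove-cases {J} mis
      with any? (λ z → z ∈? (X - v) ×-dec ¬? (z ∈? J) ×-dec ¬? (neighbourIn? (J - v) z))
    ... | yes (z , z∈X-v , z∉J , ¬nbr) = inj₂ (z , mis-privateNeighbour mis z∈X-v z∉J ¬nbr)
    ... | no noPrivate = inj₁ (mis-remove mis dom)
      where
      dom : ∀ {z} → z ∈ X - v → z ∉ J → NeighbourIn (J - v) z
      dom {z} z∈X-v z∉J with neighbourIn? (J - v) z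
      ... | yes nbr = nbr
      ... | no ¬nbr = ⊥-elim (noPrivate (z , z∈X-v , z∉J , ¬nbr))

    atMost-mis-remove : v ∈ X → AtMost k (MaximalIndependentIn (X - v)) →
      (∀ w → Adj G v w → AtMost m (MaximalIndependentIn (nonNbrs G v w ∩ (X - v)))) →
      AtMost (k + n * m) (MaximalIndependentIn X)
    atMost-mis-remove v∈X bound bound′ = atMost-⊆ classify (atMost-⊎
      (atMost-injective (_- v) proj₂ (λ a b → mis-remove-injective v∈X (proj₁ a) (proj₁ b)) bound)
      (atMost-⋃ λ w → atMost-byWitness λ (_ , adj , _) →
        atMost-injective (_- v) (proj₂ ∘ proj₂) (λ a b → mis-remove-injective v∈X (proj₁ a) (proj₁ b))
          (bound′ w adj)))
      where
      classify : ∀ {J} → MaximalIndependentIn X J →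
        (MaximalIndependentIn X J × MaximalIndependentIn (X - v) (J - v)) ⊎
        ∃ λ w → MaximalIndependentIn X J × Adj G v w × MaximalIndependentIn (nonNbrs G v w ∩ (X - v)) (J - v)
      classify mis with mis-remove-cases mis
      ... | inj₁ mis′ = inj₁ (mis , mis′)
      ... | inj₂ (w , adj , mis′) = inj₂ (w , mis , adj , mis′)

-- Padding an induced subgraph to N vertices

module _ (G : Graph n) (f : Fin N → Maybe (Fin n)) where

  pullbackEdge : Maybe (Fin n) → Maybe (Fin n) → Bool
  pullbackEdge (just a) (just b) = E G a b
  pullbackEdge _        _        = false

  pullback : Graph N
  pullback = record
    { E   = λ i j → pullbackEdge (f i) (f j)
    ; sym = λ i j → pullbackEdge-sym (f i) (f j)
    ; irr = λ i → pullbackEdge-irr (f i)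
    }
    where
    pullbackEdge-sym : ∀ p q → pullbackEdge p q ≡ pullbackEdge q p
    pullbackEdge-sym (just a) (just b) = Graph.sym G a b
    pullbackEdge-sym (just _) nothing  = refl
    pullbackEdge-sym nothing  (just _) = refl
    pullbackEdge-sym nothing  nothing  = refl
    pullbackEdge-irr : ∀ p → pullbackEdge p p ≡ false
    pullbackEdge-irr (just a) = Graph.irr G a
    pullbackEdge-irr nothing  = refl

  pullbackSet : Subset n → Subset N
  pullbackSet J = tabulate λ i → maybe (lookup J) true (f i)

  module _ {J : Subset n} {i : Fin N} where

    ∈-pullbackSet⁺ : ∀ {a} → f i ≡ just a → a ∈ J → i ∈ pullbackSet J
    ∈-pullbackSet⁺ fi≡a a∈J =
      ∈-tabulate⁺ (trans (cong (maybe (lookup J) true) fi≡a) ([]=⇒lookup a∈J))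

    ∈-pullbackSet⁻ : ∀ {a} → f i ≡ just a → i ∈ pullbackSet J → a ∈ J
    ∈-pullbackSet⁻ {a} fi≡a i∈ =
      lookup⇒[]= a J (trans (sym (cong (maybe (lookup J) true) fi≡a)) (∈-tabulate⁻ i∈))

    ∈-pullbackSet-nothing : f i ≡ nothing → i ∈ pullbackSet J
    ∈-pullbackSet-nothing fi≡nothing = ∈-tabulate⁺ (cong (maybe (lookup J) true) fi≡nothing)

  module _ {X : Subset n}
           (sound : ∀ {i a} → f i ≡ just a → a ∈ X)
           (complete : ∀ {a} → a ∈ X → ∃ λ i → f i ≡ just a) where

    open MaximalIndependentIn

    mis-pullback : ∀ {J} → MaximalIndependentIn G X J → MaximalIndependent pullback (pullbackSet J)
    mis-pullback {J} mis = independent′ , maximal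
      where
      independent′ : Independent pullback (pullbackSet J)
      independent′ x y x∈ y∈ with f x in fx | f y in fy
      ... | just a  | just b  = independent mis a b (∈-pullbackSet⁻ fx x∈) (∈-pullbackSet⁻ fy y∈)
      ... | just _  | nothing = refl
      ... | nothing | _       = refl
      maximal : ∀ S′ → pullbackSet J ⊆ S′ → Independent pullback S′ → S′ ⊆ pullbackSet J
      maximal S′ J⊆S′ indS′ {i} i∈S′ with f i in fi
      ... | nothing = ∈-pullbackSet-nothing {J = J} fi
      ... | just z with z ∈? J
      ...   | yes z∈J = ∈-pullbackSet⁺ {J = J} fi z∈J
      ...   | no z∉J with dominating mis (sound fi) z∉J
      ...     | y , y∈J , adj with complete (J⊆X mis y∈J)
      ...       | j , fj = ⊥-elim (false≢true (trans (sym noEdge) (trans (cong₂ pullbackEdge fi fj) adj)))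
        where
        noEdge : pullbackEdge (f i) (f j) ≡ false
        noEdge = indS′ i j i∈S′ (J⊆S′ (∈-pullbackSet⁺ fj y∈J))

    pullbackSet-⊆ : ∀ {J₁ J₂} → J₁ ⊆ X → pullbackSet J₁ ⊆ pullbackSet J₂ → J₁ ⊆ J₂
    pullbackSet-⊆ J₁⊆X sub a∈J₁ with complete (J₁⊆X a∈J₁)
    ... | i , fi = ∈-pullbackSet⁻ fi (sub (∈-pullbackSet⁺ fi a∈J₁))

    atMost-mis-pullback : AtMost m (MaximalIndependent pullback) → AtMost m (MaximalIndependentIn G X)
    atMost-mis-pullback = atMost-injective pullbackSet mis-pullback λ mis₁ mis₂ eq → ⊆-antisym
      (pullbackSet-⊆ (J⊆X mis₁) (⊆-reflexive eq)) (pullbackSet-⊆ (J⊆X mis₂) (⊆-reflexive (sym eq)))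

enumerate : (X : Subset n) → ∣ X ∣ ≤ N → Fin N → Maybe (Fin n)
enumerate []          _         _       = nothing
enumerate (true ∷ X)  (s≤s _)   zero    = just zero
enumerate (true ∷ X)  (s≤s ∣X∣≤N) (suc i) = Maybe.map suc (enumerate X ∣X∣≤N i)
enumerate (false ∷ X) ∣X∣≤N     i       = Maybe.map suc (enumerate X ∣X∣≤N i)

enumerate-sound : ∀ (X : Subset n) (∣X∣≤N : ∣ X ∣ ≤ N) {i a} →
  enumerate X ∣X∣≤N i ≡ just a → a ∈ X
enumerate-sound (true ∷ X)  (s≤s _)     {zero}  refl = here
enumerate-sound (true ∷ X)  (s≤s ∣X∣≤N) {suc i} eq with enumerate X ∣X∣≤N i in e
enumerate-sound (true ∷ X)  (s≤s ∣X∣≤N) {suc i} refl | just _ = there (enumerate-sound X ∣X∣≤N e)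
enumerate-sound (false ∷ X) ∣X∣≤N       {i}     eq with enumerate X ∣X∣≤N i in e
enumerate-sound (false ∷ X) ∣X∣≤N       {i}     refl | just _ = there (enumerate-sound X ∣X∣≤N e)

enumerate-complete : ∀ (X : Subset n) (∣X∣≤N : ∣ X ∣ ≤ N) {a} → a ∈ X →
  ∃ λ i → enumerate X ∣X∣≤N i ≡ just a
enumerate-complete (true ∷ X)  (s≤s _)     here          = zero , refl
enumerate-complete (true ∷ X)  (s≤s ∣X∣≤N) (there a∈X) with enumerate-complete X ∣X∣≤N a∈X
... | i , e = suc i , cong (Maybe.map suc) e
enumerate-complete (false ∷ X) ∣X∣≤N       (there a∈X) with enumerate-complete X ∣X∣≤N a∈X
... | i , e = i , cong (Maybe.map suc) e

atMost-mis-small : (G : Graph n) {X : Subset n} → ∣ X ∣ ≤ N →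
  (∀ (H : Graph N) → AtMost m (MaximalIndependent H)) → AtMost m (MaximalIndependentIn G X)
atMost-mis-small G {X} ∣X∣≤N bound =
  atMost-mis-pullback G (enumerate X ∣X∣≤N) (enumerate-sound X ∣X∣≤N) (enumerate-complete X ∣X∣≤N)
    (bound (pullback G (enumerate X ∣X∣≤N)))

-- Maximal stars

∈-∪⁅⁆⁻ : ∀ {i} → i ∈ S ∪ ⁅ z ⁆ → i ∈ S ⊎ i ≡ z
∈-∪⁅⁆⁻ {S = S} {z = z} = Sum.map₂ (x∈⁅y⁆⇒x≡y z) ∘ x∈p∪q⁻ S ⁅ z ⁆

∪⁅⁆-mono : T ⊆ S → T ∪ ⁅ z ⁆ ⊆ S ∪ ⁅ z ⁆
∪⁅⁆-mono {S = S} {z = z} T⊆S i∈ with ∈-∪⁅⁆⁻ i∈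
... | inj₁ i∈T = p⊆p∪q ⁅ z ⁆ (T⊆S i∈T)
... | inj₂ refl = q⊆p∪q S ⁅ z ⁆ (x∈⁅x⁆ z)

Partition : Subset n → Subset n → Subset n → Set
Partition S T I = ∀ x → x ∈ S → (x ∈ T × x ∉ I) ⊎ (x ∉ T × x ∈ I)

partition-∉ : ∀ {x} → Partition S T I → T ⊆ S → x ∈ T → x ∉ I
partition-∉ part T⊆S x∈T x∈I =
  [ (λ (_ , x∉I) → x∉I x∈I) , (λ (x∉T , _) → x∉T x∈T) ] (part _ (T⊆S x∈T))

partition-swap : Partition S T I → Partition S I T
partition-swap part x x∈S = Sum.swap (Sum.map Prod.swap Prod.swap (part x x∈S))

partition-extend : Partition S T I → I ⊆ S → z ∉ S → Partition (S ∪ ⁅ z ⁆) (T ∪ ⁅ z ⁆) I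
partition-extend {S = S} {T = T} {z = z} part I⊆S z∉S i i∈ with ∈-∪⁅⁆⁻ i∈
... | inj₂ refl = inj₁ (q⊆p∪q T ⁅ z ⁆ (x∈⁅x⁆ z) , z∉S ∘ I⊆S)
... | inj₁ i∈S with part i i∈S
...   | inj₁ (i∈T , i∉I) = inj₁ (p⊆p∪q ⁅ z ⁆ i∈T , i∉I)
...   | inj₂ (i∉T , i∈I) = inj₂ ([ i∉T , (λ { refl → z∉S i∈S }) ] ∘ ∈-∪⁅⁆⁻ , i∈I)

module _ (G : Graph n) where

  center : IsStar G S → Fin n
  center (_ , _ , _ , _ , _ , (x , _) , _) = x

  center∈ : (star : IsStar G S) → center star ∈ S
  center∈ (_ , _ , _ , T⊆S , _ , (_ , x∈T , _) , _) = T⊆S x∈T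

  star-independent : (star : IsStar G S) → Independent G (S - center star)
  star-independent (T , I , part , T⊆S , I⊆S , (x , x∈T , _ , noT) , indI , TI) a b a∈ b∈
    with part a (x∈p-y⇒x∈p a∈) | part b (x∈p-y⇒x∈p b∈)
  ... | inj₁ (a∈T , _) | inj₁ (b∈T , _) = noT a b a∈T b∈T (x∈p-y⇒x≢y a∈) (x∈p-y⇒x≢y b∈)
  ... | inj₁ (a∈T , _) | inj₂ (_ , b∈I) = TI a b a∈T b∈I
  ... | inj₂ (_ , a∈I) | inj₁ (b∈T , _) = nonAdj-sym G (TI b a b∈T a∈I)
  ... | inj₂ (_ , a∈I) | inj₂ (_ , b∈I) = indI a b a∈I b∈I

  -- z joins the tree if it is adjacent to the center, and the independent part otherwise.
  star-extend : (star : IsStar G S) → z ∉ S →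
    (∀ {y} → y ∈ S → y ≢ center star → E G z y ≡ false) → IsStar G (S ∪ ⁅ z ⁆)
  star-extend {S = S} {z = z} (T , I , part , T⊆S , I⊆S , (x , x∈T , adj , noT) , indI , TI) z∉S nonAdj
    with E G x z in x~z
  ... | true = T ∪ ⁅ z ⁆ , I , partition-extend part I⊆S z∉S , ∪⁅⁆-mono T⊆S , p⊆p∪q ⁅ z ⁆ ∘ I⊆S ,
               (x , p⊆p∪q ⁅ z ⁆ x∈T , adj′ , noT′) , indI , TI′
    where
    adj′ : ∀ y → y ∈ T ∪ ⁅ z ⁆ → y ≢ x → Adj G x y
    adj′ y y∈ y≢x with ∈-∪⁅⁆⁻ y∈
    ... | inj₁ y∈T = adj y y∈T y≢x
    ... | inj₂ refl = x~z
    noT′ : ∀ y w → y ∈ T ∪ ⁅ z ⁆ → w ∈ T ∪ ⁅ z ⁆ → y ≢ x → w ≢ x → E G y w ≡ false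
    noT′ y w y∈ w∈ y≢x w≢x with ∈-∪⁅⁆⁻ y∈ | ∈-∪⁅⁆⁻ w∈
    ... | inj₁ y∈T  | inj₁ w∈T  = noT y w y∈T w∈T y≢x w≢x
    ... | inj₁ y∈T  | inj₂ refl = nonAdj-sym G (nonAdj (T⊆S y∈T) y≢x)
    ... | inj₂ refl | inj₁ w∈T  = nonAdj (T⊆S w∈T) w≢x
    ... | inj₂ refl | inj₂ refl = Graph.irr G z
    TI′ : ∀ a b → a ∈ T ∪ ⁅ z ⁆ → b ∈ I → E G a b ≡ false
    TI′ a b a∈ b∈I with ∈-∪⁅⁆⁻ a∈
    ... | inj₁ a∈T = TI a b a∈T b∈I
    ... | inj₂ refl = nonAdj (I⊆S b∈I) λ { refl → partition-∉ part T⊆S x∈T b∈I }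
  ... | false = T , I ∪ ⁅ z ⁆ , partition-swap (partition-extend (partition-swap part) T⊆S z∉S) ,
                p⊆p∪q ⁅ z ⁆ ∘ T⊆S , ∪⁅⁆-mono I⊆S , (x , x∈T , adj , noT) , indI′ , TI′
    where
    indI′ : Independent G (I ∪ ⁅ z ⁆)
    indI′ a b a∈ b∈ with ∈-∪⁅⁆⁻ a∈ | ∈-∪⁅⁆⁻ b∈
    ... | inj₁ a∈I  | inj₁ b∈I  = indI a b a∈I b∈I
    ... | inj₁ a∈I  | inj₂ refl =
      nonAdj-sym G (nonAdj (I⊆S a∈I) λ { refl → partition-∉ part T⊆S x∈T a∈I })
    ... | inj₂ refl | inj₁ b∈I  = nonAdj (I⊆S b∈I) λ { refl → partition-∉ part T⊆S x∈T b∈I }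
    ... | inj₂ refl | inj₂ refl = Graph.irr G z
    TI′ : ∀ a b → a ∈ T → b ∈ I ∪ ⁅ z ⁆ → E G a b ≡ false
    TI′ a b a∈T b∈ with ∈-∪⁅⁆⁻ b∈ | a ≟ x
    ... | inj₁ b∈I  | _        = TI a b a∈T b∈I
    ... | inj₂ refl | yes refl = x~z
    ... | inj₂ refl | no a≢x   = nonAdj-sym G (nonAdj (T⊆S a∈T) a≢x)

  maximalStar⇒mis : MaximalStar G S →
    ∃ λ x → x ∈ S × MaximalIndependentIn G (⊤ - x) (S - x)
  maximalStar⇒mis {S = S} (star , maximal) = x₀ , center∈ star , record
    { J⊆X         = p⊆q⇒p-x⊆q-x ⊆⊤
    ; independent = star-independent star
    ; dominating  = dominating
    }
    where
    x₀ = center star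
    dominating : ∀ {z} → z ∈ ⊤ - x₀ → z ∉ S - x₀ → NeighbourIn G (S - x₀) z
    dominating {z} z∈⊤-x z∉S-x with neighbourIn? G (S - x₀) z
    ... | yes nbr = nbr
    ... | no ¬nbr = ⊥-elim (z∉S (maximal (S ∪ ⁅ z ⁆) (p⊆p∪q ⁅ z ⁆) (star-extend star z∉S nonAdj)
                                  (q⊆p∪q S ⁅ z ⁆ (x∈⁅x⁆ z))))
      where
      z∉S : z ∉ S
      z∉S z∈S = z∉S-x (x∈p∧x≢y⇒x∈p-y z∈S (x∈p-y⇒x≢y z∈⊤-x))
      nonAdj : ∀ {y} → y ∈ S → y ≢ x₀ → E G z y ≡ false
      nonAdj y∈S y≢x = ¬-not λ z~y → ¬nbr (_ , x∈p∧x≢y⇒x∈p-y y∈S y≢x , z~y)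

-- Complements of c-closed graphs

module _ {c m : ℕ} (G : Graph n) (coclosed : CoClosed c G)
         (bound : ∀ (H : Graph (c ∸ 1)) → AtMost m (MaximalIndependent H)) where

  atMost-mis-nonNbrs : ∀ {v w} X → Adj G v w → AtMost m (MaximalIndependentIn G (nonNbrs G v w ∩ X))
  atMost-mis-nonNbrs {v} {w} X v~w =
    atMost-mis-small G
      (∸-monoˡ-≤ 1 (≤-trans (s≤s (∣p∩q∣≤∣p∣ (nonNbrs G v w) X)) (coclosed v w v~w))) bound

  atMost-mis : ∀ s {X} → ∣ X ∣ ≤ s → AtMost (1 + s * (n * m)) (MaximalIndependentIn G X)
  atMost-mis s {X} ∣X∣≤s with nonempty? X
  atMost-mis s       ∣X∣≤s | no empty = atMost-mono (m≤m+n 1 _) (atMost-subsingleton (mis-empty G empty))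
  atMost-mis zero    ∣X∣≤0 | yes (v , v∈X) = ⊥-elim (n≮0 (<-≤-trans (x∈p⇒∣p-x∣<∣p∣ v∈X) ∣X∣≤0))
  atMost-mis (suc s) {X} ∣X∣≤s+1 | yes (v , v∈X) =
    atMost-mono (≤-reflexive (cong suc (+-comm (s * (n * m)) (n * m))))
      (atMost-mis-remove G v∈X
        (atMost-mis s (≤-pred (<-≤-trans (x∈p⇒∣p-x∣<∣p∣ v∈X) ∣X∣≤s+1)))
        (λ w → atMost-mis-nonNbrs (X - v)))

  atMost-maximalStar : AtMost (n * (1 + (n ∸ 1) * (n * m))) (MaximalStar G)
  atMost-maximalStar = atMost-⊆ (maximalStar⇒mis G) (atMost-⋃ λ x →
    atMost-injective (_- x) proj₂ (λ (x∈S₁ , _) (x∈S₂ , _) → p-x≡q-x⇒p≡q x∈S₁ x∈S₂)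
      (atMost-mis (n ∸ 1) (∣⊤-x∣≤n∸1 x)))

M₀-positive : (∀ (H : Graph N) → AtMost m (MaximalIndependent H)) → 1 ≤ m
M₀-positive {N} bound =
  bound edgeless (⊤ ∷ []) ([] ∷ []) (((λ _ _ _ _ → refl) , (λ _ _ _ _ → ∈⊤)) ∷ [])
  where
  edgeless : Graph N
  edgeless = record { E = λ _ _ → false ; sym = λ _ _ → refl ; irr = λ _ → refl }

-- n ^ 3 unfolds to n * (n * (n * 1)).
cube : ∀ n m → n * (n * (n * m)) ≡ n * (n * (n * 1)) * m
cube = solve-∀

cube-bound : ∀ n m → 1 ≤ m → n * (1 + (n ∸ 1) * (n * m)) ≤ n ^ 3 * m
cube-bound zero    m _   = z≤n
cube-bound (suc k) m 1≤m = begin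
  suc k * (1 + k * (suc k * m))             ≤⟨ *-monoʳ-≤ (suc k) (+-monoˡ-≤ (k * (suc k * m)) 1≤n*m) ⟩
  suc k * (suc k * (suc k * m))             ≡⟨ cube (suc k) m ⟩
  suc k ^ 3 * m                             ∎
  where
  open ≤-Reasoning
  1≤n*m : 1 ≤ suc k * m
  1≤n*m = ≤-trans 1≤m (m≤m+n m (k * m))

lemma31 : (n c m : ℕ) (G : Graph n) → CoClosed c G → IsM₀ (c ∸ 1) m →
    (L : List (Subset n)) → Unique L → All (MaximalStar G) L →
    length L ≤ n ^ 3 * m
lemma31 n c m G coclosed (bound , _) =
  atMost-mono (cube-bound n m (M₀-positive bound)) (atMost-maximalStar G coclosed bound)
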